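{- For integers $n,k,r\ge 0$ with $n\ge k$, \[ U_r(n,k)=\sum_{l=k}^{n}\binom{n}{l}U(l,k)\,r^{n-l}. \]
   Context: For a nonnegative integer $r$, the numbers $U_r(n,k)$ ($n,k\ge 0$ integers) are defined by $U_r(n,k)=U_r(n-1,k-1)+(k^2+r)\,U_r(n-1,k)$ for $n\ge k\ge 1$, with $U_r(n,0)=r^n$ (with $0^0=1$), $U_r(0,k)=\delta_{k0}$, and $U_r(n,k)=0$ for $k>n$. The central factorial numbers with even indices of the second kind are $U(n,k):=U_0(n,k)$ (equivalently $U(n,k)=T(2n,2k)$ where $T$ are the central factorial numbers of the second kind). -}

module Defs where

open import Data.Nat using (ℕ; zero; suc; _+_; _*_; _^_)

-- U_r(n,k): U r n k, via the recurrence
--   U_r(n,k) = U_r(n-1,k-1) + (k^2+r) U_r(n-1,k)  (n ≥ k ≥ 1)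
--   U_r(n,0) = r^n (0^0 = 1),  U_r(0,k) = δ_{k0},  U_r(n,k) = 0 for k > n.
-- (For k > n the recurrence with these initial values gives 0 automatically.)
U : ℕ → ℕ → ℕ → ℕ
U r n       zero    = r ^ n
U r zero    (suc k) = 0
U r (suc n) (suc k) = U r n k + ((suc k) * (suc k) + r) * U r n (suc k)

-- Central factorial numbers with even indices of the second kind: U(n,k) = U_0(n,k)
U₀ : ℕ → ℕ → ℕ
U₀ = U 0

ΣFrom : ℕ → ℕ → (ℕ → ℕ) → ℕ
ΣFrom a zero    f = 0
ΣFrom a (suc m) f = f a + ΣFrom (suc a) m f

-- Both sides satisfy the defining recurrence of U_r.  With
-- B f n = Σ_{l=0}^{n} (n choose l) f(l) r^(n-l), Pascal's rule gives
-- B f (n+1) = r · B f n + B (f ∘ suc) n, while U(l+1,k+1) = U(l,k) + (k+1)² U(l,k+1)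
-- and B is linear; so B (U(·,k)) n obeys the recurrence of U_r(n,k), and its
-- initial values are r^n (from U(l,0) = 0^l) and 0.  The terms l < k vanish.
module Submission where

open import Defs
open import Data.Nat using (ℕ; zero; suc; _+_; _*_; _^_; _∸_; _≤_; _<_; s≤s)
open import Data.Nat.Combinatorics using (_C_; nCk+nC[k+1]≡[n+1]C[k+1])
open import Data.Nat.Combinatorics.Specification using (k>n⇒nCk≡0)
open import Data.Nat.Properties
open import Data.Nat.Solver using (module +-*-Solver)
open import Relation.Binary.PropositionalEquality
open import Relation.Nullary using (yes; no)
open +-*-Solver
open ≡-Reasoning

ΣFrom-cong : ∀ a m {f g : ℕ → ℕ} → (∀ l → f l ≡ g l) → ΣFrom a m f ≡ ΣFrom a m g
ΣFrom-cong a zero    f≗g = refl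
ΣFrom-cong a (suc m) f≗g = cong₂ _+_ (f≗g a) (ΣFrom-cong (suc a) m f≗g)

ΣFrom-distrib-+ : ∀ a m (f g : ℕ → ℕ) →
  ΣFrom a m (λ l → f l + g l) ≡ ΣFrom a m f + ΣFrom a m g
ΣFrom-distrib-+ a zero    f g = refl
ΣFrom-distrib-+ a (suc m) f g = begin
  f a + g a + ΣFrom (suc a) m (λ l → f l + g l)
    ≡⟨ cong (f a + g a +_) (ΣFrom-distrib-+ (suc a) m f g) ⟩
  f a + g a + (ΣFrom (suc a) m f + ΣFrom (suc a) m g)
    ≡⟨ solve 4 (λ x y s t → x :+ y :+ (s :+ t) := x :+ s :+ (y :+ t)) refl
         (f a) (g a) (ΣFrom (suc a) m f) (ΣFrom (suc a) m g) ⟩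
  f a + ΣFrom (suc a) m f + (g a + ΣFrom (suc a) m g) ∎

ΣFrom-*ˡ : ∀ a m c (f : ℕ → ℕ) → ΣFrom a m (λ l → c * f l) ≡ c * ΣFrom a m f
ΣFrom-*ˡ a zero    c f = sym (*-zeroʳ c)
ΣFrom-*ˡ a (suc m) c f =
  trans (cong (c * f a +_) (ΣFrom-*ˡ (suc a) m c f)) (sym (*-distribˡ-+ c (f a) _))

ΣFrom-suc : ∀ a m (f : ℕ → ℕ) → ΣFrom (suc a) m f ≡ ΣFrom a m (λ l → f (suc l))
ΣFrom-suc a zero    f = refl
ΣFrom-suc a (suc m) f = cong (f (suc a) +_) (ΣFrom-suc (suc a) m f)

ΣFrom-snoc : ∀ a m (f : ℕ → ℕ) → ΣFrom a (suc m) f ≡ ΣFrom a m f + f (a + m)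
ΣFrom-snoc a zero    f = trans (+-comm (f a) 0) (cong f (sym (+-identityʳ a)))
ΣFrom-snoc a (suc m) f = begin
  f a + ΣFrom (suc a) (suc m) f          ≡⟨ cong (f a +_) (ΣFrom-snoc (suc a) m f) ⟩
  f a + (ΣFrom (suc a) m f + f (suc a + m)) ≡⟨ sym (+-assoc (f a) _ _) ⟩
  f a + ΣFrom (suc a) m f + f (suc a + m)   ≡⟨ cong (λ i → f a + ΣFrom (suc a) m f + f i) (sym (+-suc a m)) ⟩
  f a + ΣFrom (suc a) m f + f (a + suc m)   ∎

ΣFrom-split : ∀ a m n (f : ℕ → ℕ) → ΣFrom a (m + n) f ≡ ΣFrom a m f + ΣFrom (a + m) n f
ΣFrom-split a zero    n f = cong (λ i → ΣFrom i n f) (sym (+-identityʳ a))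
ΣFrom-split a (suc m) n f = begin
  f a + ΣFrom (suc a) (m + n) f                      ≡⟨ cong (f a +_) (ΣFrom-split (suc a) m n f) ⟩
  f a + (ΣFrom (suc a) m f + ΣFrom (suc a + m) n f)  ≡⟨ sym (+-assoc (f a) _ _) ⟩
  f a + ΣFrom (suc a) m f + ΣFrom (suc a + m) n f    ≡⟨ cong (λ i → f a + ΣFrom (suc a) m f + ΣFrom i n f) (sym (+-suc a m)) ⟩
  f a + ΣFrom (suc a) m f + ΣFrom (a + suc m) n f    ∎

ΣFrom-vanishing : ∀ a m (f : ℕ → ℕ) → (∀ l → a ≤ l → l < a + m → f l ≡ 0) → ΣFrom a m f ≡ 0
ΣFrom-vanishing a zero    f f≡0 = refl
ΣFrom-vanishing a (suc m) f f≡0 = cong₂ _+_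
  (f≡0 a ≤-refl (≤-trans (s≤s (m≤m+n a m)) (≤-reflexive (sym (+-suc a m)))))
  (ΣFrom-vanishing (suc a) m f (λ l a<l l<a+m →
     f≡0 l (<⇒≤ a<l) (≤-trans l<a+m (≤-reflexive (sym (+-suc a m))))))

n<k⇒U≡0 : ∀ r {n k} → n < k → U r n k ≡ 0
n<k⇒U≡0 r {zero}  {suc k} n<k       = refl
n<k⇒U≡0 r {suc n} {suc k} (s≤s n<k) = begin
  U r n k + (suc k * suc k + r) * U r n (suc k)
    ≡⟨ cong₂ (λ x y → x + (suc k * suc k + r) * y) (n<k⇒U≡0 r n<k) (n<k⇒U≡0 r (m<n⇒m<1+n n<k)) ⟩
  (suc k * suc k + r) * 0
    ≡⟨ *-zeroʳ (suc k * suc k + r) ⟩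
  0 ∎

module _ (r : ℕ) where

  binomialTransform : (ℕ → ℕ) → ℕ → ℕ
  binomialTransform f n = ΣFrom 0 (suc n) (λ l → (n C l) * f l * r ^ (n ∸ l))

  -- For l ≥ n both sides vanish since n C suc l = 0; otherwise n ∸ l = suc (n ∸ suc l).
  C[suc]-weight : ∀ n l x →
    (n C suc l) * x * r ^ (n ∸ l) ≡ r * ((n C suc l) * x * r ^ (n ∸ suc l))
  C[suc]-weight n l x with l <? n
  ... | yes l<n = begin
    (n C suc l) * x * r ^ (n ∸ l)             ≡⟨ cong (λ e → (n C suc l) * x * r ^ e) (+-∸-assoc 1 l<n) ⟩
    (n C suc l) * x * (r * r ^ (n ∸ suc l))   ≡⟨ solve 4 (λ c y q s → c :* y :* (s :* q) := s :* (c :* y :* q)) refl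
                                                   (n C suc l) x (r ^ (n ∸ suc l)) r ⟩
    r * ((n C suc l) * x * r ^ (n ∸ suc l))   ∎
  ... | no l≮n rewrite k>n⇒nCk≡0 {n} {suc l} (s≤s (≮⇒≥ l≮n)) = sym (*-zeroʳ r)

  binomialTransform-suc : ∀ f n →
    binomialTransform f (suc n) ≡ r * binomialTransform f n + binomialTransform (λ l → f (suc l)) n
  binomialTransform-suc f n = begin
    binomialTransform f (suc n)
      ≡⟨ cong (term (suc n) 0 +_) (ΣFrom-suc 0 (suc n) (term (suc n))) ⟩
    term (suc n) 0 + ΣFrom 0 (suc n) (λ l → term (suc n) (suc l))
      ≡⟨ cong (term (suc n) 0 +_) (ΣFrom-cong 0 (suc n) pascal) ⟩
    term (suc n) 0 + ΣFrom 0 (suc n) (λ l → r * term n (suc l) + shiftedTerm l)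
      ≡⟨ cong (term (suc n) 0 +_) (ΣFrom-distrib-+ 0 (suc n) (λ l → r * term n (suc l)) shiftedTerm) ⟩
    term (suc n) 0 + (ΣFrom 0 (suc n) (λ l → r * term n (suc l)) + B↑)
      ≡⟨ cong (λ s → term (suc n) 0 + (s + B↑))
              (trans (ΣFrom-*ˡ 0 (suc n) r _) (cong (r *_) (sym (ΣFrom-suc 0 (suc n) (term n))))) ⟩
    term (suc n) 0 + (r * ΣFrom 1 (suc n) (term n) + B↑)
      ≡⟨ solve 5 (λ x s t q b → con 1 :* x :* (s :* q) :+ (s :* t :+ b) := s :* (con 1 :* x :* q :+ t) :+ b) refl
           (f 0) r (ΣFrom 1 (suc n) (term n)) (r ^ n) B↑ ⟩
    r * ΣFrom 0 (suc (suc n)) (term n) + B↑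
      ≡⟨ cong (λ s → r * s + B↑) (ΣFrom-snoc 0 (suc n) (term n)) ⟩
    r * (binomialTransform f n + term n (suc n)) + B↑
      ≡⟨ cong (λ t → r * t + B↑) (trans (cong (binomialTransform f n +_) last-term≡0) (+-identityʳ _)) ⟩
    r * binomialTransform f n + B↑ ∎
    where
    term : ℕ → ℕ → ℕ
    term m l = (m C l) * f l * r ^ (m ∸ l)
    shiftedTerm : ℕ → ℕ
    shiftedTerm l = (n C l) * f (suc l) * r ^ (n ∸ l)
    B↑ : ℕ
    B↑ = binomialTransform (λ l → f (suc l)) n
    last-term≡0 : term n (suc n) ≡ 0
    last-term≡0 = cong (λ c → c * f (suc n) * r ^ (n ∸ suc n)) (k>n⇒nCk≡0 (n<1+n n))
    pascal : ∀ l → term (suc n) (suc l) ≡ r * term n (suc l) + shiftedTerm l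
    pascal l = begin
      term (suc n) (suc l)
        ≡⟨ cong (λ c → c * f (suc l) * r ^ (n ∸ l)) (sym (nCk+nC[k+1]≡[n+1]C[k+1] n l)) ⟩
      (n C l + n C suc l) * f (suc l) * r ^ (n ∸ l)
        ≡⟨ solve 4 (λ a b x p → (a :+ b) :* x :* p := b :* x :* p :+ a :* x :* p) refl
             (n C l) (n C suc l) (f (suc l)) (r ^ (n ∸ l)) ⟩
      (n C suc l) * f (suc l) * r ^ (n ∸ l) + shiftedTerm l
        ≡⟨ cong (_+ shiftedTerm l) (C[suc]-weight n l (f (suc l))) ⟩
      r * term n (suc l) + shiftedTerm l ∎

  binomialTransform-linear : ∀ f g c n →
    binomialTransform (λ l → f l + c * g l) n ≡ binomialTransform f n + c * binomialTransform g n
  binomialTransform-linear f g c n = begin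
    binomialTransform (λ l → f l + c * g l) n
      ≡⟨ ΣFrom-cong 0 (suc n) (λ l → solve 5
           (λ a x s y p → a :* (x :+ s :* y) :* p := a :* x :* p :+ s :* (a :* y :* p)) refl
           (n C l) (f l) c (g l) (r ^ (n ∸ l))) ⟩
    ΣFrom 0 (suc n) (λ l → (n C l) * f l * r ^ (n ∸ l) + c * ((n C l) * g l * r ^ (n ∸ l)))
      ≡⟨ ΣFrom-distrib-+ 0 (suc n) (λ l → (n C l) * f l * r ^ (n ∸ l)) (λ l → c * ((n C l) * g l * r ^ (n ∸ l))) ⟩
    binomialTransform f n + ΣFrom 0 (suc n) (λ l → c * ((n C l) * g l * r ^ (n ∸ l)))
      ≡⟨ cong (binomialTransform f n +_) (ΣFrom-*ˡ 0 (suc n) c _) ⟩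
    binomialTransform f n + c * binomialTransform g n ∎

  binomialTransform-δ : ∀ n → binomialTransform (λ l → 0 ^ l) n ≡ r ^ n
  binomialTransform-δ n = begin
    1 * 1 * r ^ n + ΣFrom 1 n (λ l → (n C l) * 0 ^ l * r ^ (n ∸ l))
      ≡⟨ cong (1 * 1 * r ^ n +_) (ΣFrom-vanishing 1 n _ vanish) ⟩
    1 * 1 * r ^ n + 0
      ≡⟨ +-identityʳ (1 * 1 * r ^ n) ⟩
    1 * 1 * r ^ n
      ≡⟨ *-identityˡ (r ^ n) ⟩
    r ^ n ∎
    where
    vanish : ∀ l → 1 ≤ l → l < 1 + n → (n C l) * 0 ^ l * r ^ (n ∸ l) ≡ 0
    vanish (suc l) _ _ = cong (_* r ^ (n ∸ suc l)) (*-zeroʳ (n C suc l))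

  U≡binomialTransform : ∀ n k → U r n k ≡ binomialTransform (λ l → U₀ l k) n
  U≡binomialTransform n       zero    = sym (binomialTransform-δ n)
  U≡binomialTransform zero    (suc k) = refl
  U≡binomialTransform (suc n) (suc k) = begin
    U r n k + (c + r) * U r n (suc k)
      ≡⟨ cong₂ (λ x y → x + (c + r) * y) (U≡binomialTransform n k) (U≡binomialTransform n (suc k)) ⟩
    T k + (c + r) * T (suc k)
      ≡⟨ solve 4 (λ x y s t → x :+ (s :+ t) :* y := t :* y :+ (x :+ (s :+ con 0) :* y)) refl
           (T k) (T (suc k)) c r ⟩
    r * T (suc k) + (T k + (c + 0) * T (suc k))
      ≡⟨ cong (r * T (suc k) +_) (sym (binomialTransform-linear (λ l → U₀ l k) (λ l → U₀ l (suc k)) (c + 0) n)) ⟩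
    r * T (suc k) + binomialTransform (λ l → U₀ (suc l) (suc k)) n
      ≡⟨ sym (binomialTransform-suc (λ l → U₀ l (suc k)) n) ⟩
    binomialTransform (λ l → U₀ l (suc k)) (suc n) ∎
    where
    c : ℕ
    c = suc k * suc k
    T : ℕ → ℕ
    T j = binomialTransform (λ l → U₀ l j) n

mainTheorem2 : (n k r : ℕ) → k ≤ n →
    U r n k ≡ ΣFrom k (suc (n ∸ k)) (λ l → (n C l) * U₀ l k * r ^ (n ∸ l))
mainTheorem2 n k r k≤n = begin
  U r n k                                      ≡⟨ U≡binomialTransform r n k ⟩
  ΣFrom 0 (suc n) term                         ≡⟨ cong (λ m → ΣFrom 0 m term) length-split ⟩
  ΣFrom 0 (k + suc (n ∸ k)) term               ≡⟨ ΣFrom-split 0 k (suc (n ∸ k)) term ⟩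
  ΣFrom 0 k term + ΣFrom k (suc (n ∸ k)) term  ≡⟨ cong (_+ ΣFrom k (suc (n ∸ k)) term) (ΣFrom-vanishing 0 k term below-k) ⟩
  ΣFrom k (suc (n ∸ k)) term                   ∎
  where
  term : ℕ → ℕ
  term l = (n C l) * U₀ l k * r ^ (n ∸ l)
  length-split : suc n ≡ k + suc (n ∸ k)
  length-split = trans (cong suc (sym (m+[n∸m]≡n k≤n))) (sym (+-suc k (n ∸ k)))
  below-k : ∀ l → 0 ≤ l → l < k → term l ≡ 0
  below-k l _ l<k = begin
    (n C l) * U₀ l k * r ^ (n ∸ l)  ≡⟨ cong (λ u → (n C l) * u * r ^ (n ∸ l)) (n<k⇒U≡0 0 l<k) ⟩
    (n C l) * 0 * r ^ (n ∸ l)       ≡⟨ cong (_* r ^ (n ∸ l)) (*-zeroʳ (n C l)) ⟩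
    0                               ∎
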